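{- Let $T$ be a tournament, $R$ a minimal $\tau$-retentive set of $T$, and $v\in R$. If $v$ has a tri-captain $\{a,b,c\}$ in $T[R]$ and $|N^-_{T[R]}(v)|\leq 5$, then $\{a,b,c\}=\tau(T[N^-_T(v)])$.
   Context: A tournament $T$ consists of a finite vertex set $V(T)$ and an asymmetric, complete binary relation $\succ$ on $V(T)$ ($x$ dominates $y$ if $x\succ y$). For $v\in V(T)$ let $N^-_T(v)=\{u: u\succ v\}$; for $B\subseteq V(T)$, $T[B]$ is the induced subtournament. In a tournament $S$, a set $\{a,b,c\}$ of three in-neighbors of a vertex $v$ is a tri-captain of $v$ if $a,b,c$ form a directed cycle (directed triangle) and no other in-neighbor of $v$ in $S$ dominates at least two of $a,b,c$. The tournament equilibrium set $\tau$ is defined recursively: a nonempty $A\subseteq V(T)$ is $\tau$-retentive if for every $x\in A$ with $N^-_T(x)\neq\emptyset$, $\tau(T[N^-_T(x)])\subseteq A$; $A$ is a minimal $\tau$-retentive set if no $\tau$-retentive set of $T$ is a proper subset of $A$; $\tau(T)$ is the union of all minimal $\tau$-retentive sets of $T$. -}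

module Defs where

open import Data.Nat using (ℕ; zero; suc)
open import Data.Fin using (Fin)
open import Data.Fin.Subset using (Subset; _∈_; _∉_; _⊆_; Nonempty; ⊤; ∣_∣)
open import Data.Bool using (_∧_)
open import Data.Vec using (tabulate; lookup)
open import Data.Product using (Σ; _×_; ∃)
open import Data.Sum using (_⊎_)
open import Data.Empty using (⊥)
open import Relation.Nullary using (¬_; Dec; does)
open import Relation.Binary.PropositionalEquality using (_≡_; _≢_)

record Tournament (n : ℕ) : Set₁ where
  field
    _≻_      : Fin n → Fin n → Set
    ≻-dec    : ∀ x y → Dec (x ≻ y)
    asym     : ∀ {x y} → x ≻ y → ¬ (y ≻ x)
    complete : ∀ {x y} → x ≢ y → (x ≻ y) ⊎ (y ≻ x)

module _ {n : ℕ} (T : Tournament n) where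
  open Tournament T

  N⁻ : Subset n → Fin n → Subset n
  N⁻ B x = tabulate (λ u → lookup B u ∧ does (≻-dec u x))

  -- A is τ'-retentive in T[B], where τ' gives the τ-value of subtournaments
  -- (as a predicate on vertices).
  Retentive : (Subset n → Fin n → Set) → Subset n → Subset n → Set
  Retentive τ' B A =
    A ⊆ B × Nonempty A ×
    (∀ x → x ∈ A → Nonempty (N⁻ B x) → ∀ y → τ' (N⁻ B x) y → y ∈ A)

  MinRetentive' : (Subset n → Fin n → Set) → Subset n → Subset n → Set
  MinRetentive' τ' B A =
    Retentive τ' B A × (∀ A' → Retentive τ' B A' → A' ⊆ A → A ⊆ A')

  -- τ with recursion fuel k (adequate whenever k > |B|).
  τF : ℕ → Subset n → Fin n → Set
  τF zero    B y = ⊥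
  τF (suc k) B y = ∃ λ A → MinRetentive' (τF k) B A × y ∈ A

  -- τ(T[B]) as a predicate on vertices (fuel suc n suffices: |B| ≤ n).
  τ : Subset n → Fin n → Set
  τ B = τF (suc n) B

  -- A is a minimal τ-retentive set of T[B]
  -- (in-neighbourhoods inside B have size < n, so fuel n suffices).
  MinRetentive : Subset n → Subset n → Set
  MinRetentive B A = MinRetentive' (τF n) B A

  TriCaptain : Subset n → Fin n → Fin n → Fin n → Fin n → Set
  TriCaptain R v a b c =
    (a ∈ R × b ∈ R × c ∈ R) ×
    (a ≻ v × b ≻ v × c ≻ v) ×
    ((a ≻ b × b ≻ c × c ≻ a) ⊎ (a ≻ c × c ≻ b × b ≻ a)) ×
    (∀ d → d ∈ R → d ≻ v → d ≢ a → d ≢ b → d ≢ c →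
       ¬ (d ≻ a × d ≻ b) × ¬ (d ≻ b × d ≻ c) × ¬ (d ≻ a × d ≻ c))

-- Write N = N⁻(v), S = N⁻_{T[R]}(v) and Δ = {a,b,c}, oriented a ≻ b ≻ c ≻ a.  Since R is
-- τ-retentive, every minimal τ-retentive set M of T[N] lies in S, and so do the minimal
-- retentive sets Q of in-neighbourhoods of vertices of M.  The captain condition says that
-- every vertex of S outside Δ is dominated by two vertices of Δ, so any two such vertices
-- have a common dominator in Δ.  A vertex of a retentive set that is dominated at all is
-- dominated inside the set, and a set in which every vertex is dominated has at least three
-- vertices; as |S| ≤ 5 and |Δ| = 3, such a Q always meets Δ.  This shows that M meets Δ,
-- and that τ(N⁻_N(a)) = {c} whenever a ∈ M, so M contains the whole cycle Δ.  Finally Δ is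
-- itself retentive, hence M = Δ by minimality.

module Submission where

open import Defs
open import Data.Nat using (ℕ; zero; suc; _+_; _≤_; _<_; s≤s)
open import Data.Nat.Properties using (≤-trans; <-≤-trans; ≤-pred; n≤1+n; n≮0; n≮n; +-monoʳ-≤; m+n≤o⇒m≤o)
open import Data.Fin using (Fin; zero; _≟_)
open import Data.Fin.Properties using (all?; any?)
open import Data.Fin.Subset using (Subset; _∈_; _⊆_; _⊂_; ⊤; ∣_∣; Nonempty; ⁅_⁆; _∪_; _-_)
open import Data.Fin.Subset.Properties
  using (_∈?_; _⊆?_; _⊂?_; nonempty?; anySubset?; ∣p∣≤n; ∈⊤; x∈⁅x⁆; x∈⁅y⁆⇒x≡y; x∈p∪q⁻; x∈p∪q⁺;
         x∈p∧x≢y⇒x∈p-y; x∈p⇒∣p-x∣<∣p∣; p⊆q⇒∣p∣≤∣q∣; p⊂q⇒∣p∣<∣q∣)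
open import Data.Fin.Subset.Induction using (⊂-wellFounded)
open import Induction.WellFounded using (Acc; acc)
open import Data.Bool using (true; false; _∧_)
open import Data.Vec using (lookup)
open import Data.Vec.Properties using (lookup∘tabulate; []=⇒lookup; lookup⇒[]=)
open import Data.Sum using (_⊎_; inj₁; inj₂; [_,_])
open import Data.Product using (_×_; _,_; proj₁; proj₂; ∃)
open import Data.Empty using (⊥-elim)
open import Function using (_∘_; id)
open import Function.Bundles using (_⇔_; mk⇔; Equivalence)
import Function.Properties.Equivalence as ⇔
open import Relation.Nullary using (¬_; Dec; yes; no; does)
open import Relation.Nullary.Decidable using (_×-dec_; _⊎-dec_; _→-dec_; ¬?; map′; decidable-stable; dec-true)
open import Relation.Binary.PropositionalEquality using (_≡_; _≢_; refl; sym; trans; cong₂; subst)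

TwoOf : Set → Set → Set → Set
TwoOf A B C = (A × B) ⊎ (B × C) ⊎ (C × A)

module _ {A B C : Set} where

  twoOf-rotate : TwoOf A B C → TwoOf B C A
  twoOf-rotate (inj₁ ab)        = inj₂ (inj₂ ab)
  twoOf-rotate (inj₂ (inj₁ bc)) = inj₁ bc
  twoOf-rotate (inj₂ (inj₂ ca)) = inj₂ (inj₁ ca)

  twoOf-overlap : ∀ {A′ B′ C′ : Set} → TwoOf A B C → TwoOf A′ B′ C′ →
                  (A × A′) ⊎ (B × B′) ⊎ (C × C′)
  twoOf-overlap (inj₁ (a , _))        (inj₁ (a′ , _))        = inj₁ (a , a′)
  twoOf-overlap (inj₁ (a , _))        (inj₂ (inj₂ (_ , a′))) = inj₁ (a , a′)
  twoOf-overlap (inj₁ (_ , b))        (inj₂ (inj₁ (b′ , _))) = inj₂ (inj₁ (b , b′))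
  twoOf-overlap (inj₂ (inj₁ (b , _))) (inj₁ (_ , b′))        = inj₂ (inj₁ (b , b′))
  twoOf-overlap (inj₂ (inj₁ (b , _))) (inj₂ (inj₁ (b′ , _))) = inj₂ (inj₁ (b , b′))
  twoOf-overlap (inj₂ (inj₁ (_ , c))) (inj₂ (inj₂ (c′ , _))) = inj₂ (inj₂ (c , c′))
  twoOf-overlap (inj₂ (inj₂ (c , _))) (inj₂ (inj₁ (_ , c′))) = inj₂ (inj₂ (c , c′))
  twoOf-overlap (inj₂ (inj₂ (c , _))) (inj₂ (inj₂ (c′ , _))) = inj₂ (inj₂ (c , c′))
  twoOf-overlap (inj₂ (inj₂ (_ , a))) (inj₁ (a′ , _))        = inj₁ (a , a′)

module _ {n : ℕ} where

  Among : Fin n → Fin n → Fin n → Fin n → Set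
  Among x y z t = t ≡ x ⊎ t ≡ y ⊎ t ≡ z

  among? : ∀ x y z t → Dec (Among x y z t)
  among? x y z t = t ≟ x ⊎-dec t ≟ y ⊎-dec t ≟ z

  among-rotate : ∀ {x y z t} → Among x y z t → Among y z x t
  among-rotate (inj₁ t≡x)        = inj₂ (inj₂ t≡x)
  among-rotate (inj₂ (inj₁ t≡y)) = inj₁ t≡y
  among-rotate (inj₂ (inj₂ t≡z)) = inj₂ (inj₁ t≡z)

  among-swap : ∀ {x y z t} → Among x z y t → Among x y z t
  among-swap (inj₁ t≡x)        = inj₁ t≡x
  among-swap (inj₂ (inj₁ t≡z)) = inj₂ (inj₂ t≡z)
  among-swap (inj₂ (inj₂ t≡y)) = inj₂ (inj₁ t≡y)

  triple : Fin n → Fin n → Fin n → Subset n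
  triple x y z = ⁅ x ⁆ ∪ ⁅ y ⁆ ∪ ⁅ z ⁆

  ∈triple⁺ : ∀ {x y z t} → Among x y z t → t ∈ triple x y z
  ∈triple⁺ {x} (inj₁ refl)        = x∈p∪q⁺ (inj₁ (x∈⁅x⁆ x))
  ∈triple⁺ {y = y} (inj₂ (inj₁ refl)) = x∈p∪q⁺ (inj₂ (x∈p∪q⁺ (inj₁ (x∈⁅x⁆ y))))
  ∈triple⁺ {z = z} (inj₂ (inj₂ refl)) = x∈p∪q⁺ (inj₂ (x∈p∪q⁺ (inj₂ (x∈⁅x⁆ z))))

  ∈triple⁻ : ∀ {x y z t} → t ∈ triple x y z → Among x y z t
  ∈triple⁻ {x} {y} {z} t∈ with x∈p∪q⁻ ⁅ x ⁆ (⁅ y ⁆ ∪ ⁅ z ⁆) t∈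
  ... | inj₁ t∈x = inj₁ (x∈⁅y⁆⇒x≡y x t∈x)
  ... | inj₂ t∈yz with x∈p∪q⁻ ⁅ y ⁆ ⁅ z ⁆ t∈yz
  ...   | inj₁ t∈y = inj₂ (inj₁ (x∈⁅y⁆⇒x≡y y t∈y))
  ...   | inj₂ t∈z = inj₂ (inj₂ (x∈⁅y⁆⇒x≡y z t∈z))

  three-distinct-members : ∀ {p : Subset n} {x y z} → x ∈ p → y ∈ p → z ∈ p →
                           x ≢ y → x ≢ z → y ≢ z → 3 + ∣ p - x - y - z ∣ ≤ ∣ p ∣
  three-distinct-members x∈p y∈p z∈p x≢y x≢z y≢z =
    ≤-trans (s≤s (s≤s (x∈p⇒∣p-x∣<∣p∣ z∈p-x-y)))
            (≤-trans (s≤s (x∈p⇒∣p-x∣<∣p∣ y∈p-x)) (x∈p⇒∣p-x∣<∣p∣ x∈p))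
    where
    y∈p-x = x∈p∧x≢y⇒x∈p-y y∈p (x≢y ∘ sym)
    z∈p-x-y = x∈p∧x≢y⇒x∈p-y (x∈p∧x≢y⇒x∈p-y z∈p (x≢z ∘ sym)) (y≢z ∘ sym)

module _ {n : ℕ} (T : Tournament n) where
  open Tournament T

  ≻-irrefl : ∀ {x} → ¬ (x ≻ x)
  ≻-irrefl x≻x = asym x≻x x≻x

  ≻⇒≢ : ∀ {x y} → x ≻ y → x ≢ y
  ≻⇒≢ x≻y refl = ≻-irrefl x≻y

  two-dominators : ∀ {d a b c} → d ≢ a → d ≢ b → d ≢ c →
                   ¬ (d ≻ a × d ≻ b) → ¬ (d ≻ b × d ≻ c) → ¬ (d ≻ a × d ≻ c) →
                   TwoOf (a ≻ d) (b ≻ d) (c ≻ d)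
  two-dominators d≢a d≢b d≢c ¬ab ¬bc ¬ac
    with complete (d≢a ∘ sym) | complete (d≢b ∘ sym) | complete (d≢c ∘ sym)
  ... | inj₁ a≻d | inj₁ b≻d | _        = inj₁ (a≻d , b≻d)
  ... | inj₂ d≻a | inj₁ b≻d | inj₁ c≻d = inj₂ (inj₁ (b≻d , c≻d))
  ... | inj₁ a≻d | inj₂ d≻b | inj₁ c≻d = inj₂ (inj₂ (c≻d , a≻d))
  ... | inj₂ d≻a | inj₂ d≻b | _        = ⊥-elim (¬ab (d≻a , d≻b))
  ... | _        | inj₂ d≻b | inj₂ d≻c = ⊥-elim (¬bc (d≻b , d≻c))
  ... | inj₂ d≻a | _        | inj₂ d≻c = ⊥-elim (¬ac (d≻a , d≻c))

  ∈N⁻⁺ : ∀ {B x u} → u ∈ B → u ≻ x → u ∈ N⁻ T B x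
  ∈N⁻⁺ {B} {x} {u} u∈B u≻x = lookup⇒[]= u (N⁻ T B x)
    (trans (lookup∘tabulate _ u) (cong₂ _∧_ ([]=⇒lookup u∈B) (dec-true (≻-dec u x) u≻x)))

  ∈N⁻⁻ : ∀ {B x u} → u ∈ N⁻ T B x → u ∈ B × u ≻ x
  ∈N⁻⁻ {B} {x} {u} u∈N⁻ =
    split (lookup B u) (≻-dec u x) refl (trans (sym (lookup∘tabulate _ u)) ([]=⇒lookup u∈N⁻))
    where
    split : ∀ b (u≻x? : Dec (u ≻ x)) → lookup B u ≡ b → b ∧ does u≻x? ≡ true → u ∈ B × u ≻ x
    split true  (yes u≻x) u∈B _ = lookup⇒[]= u B u∈B , u≻x
    split true  (no _)    _   ()
    split false _         _   ()

  N⁻-mono : ∀ {B B′ x} → B ⊆ B′ → N⁻ T B x ⊆ N⁻ T B′ x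
  N⁻-mono B⊆B′ u∈N⁻ = let u∈B , u≻x = ∈N⁻⁻ u∈N⁻ in ∈N⁻⁺ (B⊆B′ u∈B) u≻x

  ∣N⁻∣<∣B∣ : ∀ {B x} → x ∈ B → ∣ N⁻ T B x ∣ < ∣ B ∣
  ∣N⁻∣<∣B∣ {B} x∈B = p⊂q⇒∣p∣<∣q∣ (proj₁ ∘ ∈N⁻⁻ {B} , _ , x∈B , ≻-irrefl ∘ proj₂ ∘ ∈N⁻⁻ {B})

  τF⊆ : ∀ k {B y} → τF T k B y → y ∈ B
  τF⊆ (suc k) (A , ((A⊆B , _) , _) , y∈A) = A⊆B y∈A

  DecidableTau : (Subset n → Fin n → Set) → Set
  DecidableTau τ′ = ∀ B y → Dec (τ′ B y)

  allSubsets? : {P : Subset n → Set} → (∀ A → Dec (P A)) → Dec (∀ A → P A)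
  allSubsets? P? = map′ (λ ¬∃¬P A → decidable-stable (P? A) (λ ¬PA → ¬∃¬P (A , ¬PA)))
                        (λ ∀P (A , ¬PA) → ¬PA (∀P A))
                        (¬? (anySubset? (¬? ∘ P?)))

  retentive? : ∀ {τ′} → DecidableTau τ′ → ∀ B A → Dec (Retentive T τ′ B A)
  retentive? τ? B A =
    A ⊆? B ×-dec nonempty? A ×-dec
    all? (λ x → x ∈? A →-dec nonempty? (N⁻ T B x) →-dec
      all? (λ y → τ? (N⁻ T B x) y →-dec y ∈? A))

  minRetentive? : ∀ {τ′} → DecidableTau τ′ → ∀ B A → Dec (MinRetentive' T τ′ B A)
  minRetentive? τ? B A =
    retentive? τ? B A ×-dec
    allSubsets? (λ A′ → retentive? τ? B A′ →-dec A′ ⊆? A →-dec A ⊆? A′)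

  τF? : ∀ k → DecidableTau (τF T k)
  τF? zero    B y = no λ ()
  τF? (suc k) B y = anySubset? (λ A → minRetentive? (τF? k) B A ×-dec y ∈? A)

  minRetentive-below : ∀ {τ′} → DecidableTau τ′ → ∀ {B A} → Acc _⊂_ A → Retentive T τ′ B A →
                       ∃ λ A₀ → MinRetentive' T τ′ B A₀ × A₀ ⊆ A
  minRetentive-below {τ′} τ? {B} {A} (acc smaller) ret
    with anySubset? (λ A′ → retentive? τ? B A′ ×-dec A′ ⊂? A)
  ... | yes (A′ , ret′ , A′⊂A) =
    let A₀ , min₀ , A₀⊆A′ = minRetentive-below τ? (smaller A′⊂A) ret′
    in  A₀ , min₀ , proj₁ A′⊂A ∘ A₀⊆A′
  ... | no ¬smaller = A , (ret , minimal) , id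
    where
    minimal : ∀ A′ → Retentive T τ′ B A′ → A′ ⊆ A → A ⊆ A′
    minimal A′ ret′ A′⊆A {u} u∈A with u ∈? A′
    ... | yes u∈A′ = u∈A′
    ... | no  u∉A′ = ⊥-elim (¬smaller (A′ , ret′ , A′⊆A , u , u∈A , u∉A′))

  minRetentive-exists : ∀ k {B} → Nonempty B → ∃ (MinRetentive' T (τF T k) B)
  minRetentive-exists k {B} ne =
    let A , min , _ = minRetentive-below (τF? k) (⊂-wellFounded B) B-retentive in A , min
    where
    B-retentive : Retentive T (τF T k) B B
    B-retentive = id , ne , λ x _ _ y τy → proj₁ (∈N⁻⁻ (τF⊆ k τy))

  τF-nonempty : ∀ k {B} → Nonempty B → ∃ (τF T (suc k) B)
  τF-nonempty k ne with minRetentive-exists k ne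
  ... | A , min@((_ , (y , y∈A) , _) , _) = y , A , min , y∈A

  retentive-dominator : ∀ {k X Q q u} → Retentive T (τF T (suc k)) X Q → q ∈ Q → u ∈ X → u ≻ q →
                        ∃ λ q′ → q′ ∈ Q × q′ ≻ q
  retentive-dominator {k} {X} (_ , _ , closed) q∈Q u∈X u≻q
    with τF-nonempty k (_ , ∈N⁻⁺ u∈X u≻q)
  ... | w , τw = w , closed _ q∈Q (_ , ∈N⁻⁺ u∈X u≻q) w τw , proj₂ (∈N⁻⁻ {X} (τF⊆ (suc k) τw))

  retentive-closed : ∀ {k X M p Q} → Retentive T (τF T (suc k)) X M → p ∈ M →
                     MinRetentive' T (τF T k) (N⁻ T X p) Q → Q ⊆ M
  retentive-closed (_ , _ , closed) p∈M minQ@((Q⊆N⁻ , _) , _) w∈Q =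
    closed _ p∈M (_ , Q⊆N⁻ w∈Q) _ (_ , minQ , w∈Q)

  minRetentive⊆source : ∀ {τ′ X Q r} → MinRetentive' T τ′ X Q → r ∈ Q →
                        (∀ {u} → u ∈ X → ¬ u ≻ r) → Q ⊆ ⁅ r ⁆
  minRetentive⊆source {τ′} {X} {Q} {r} ((Q⊆X , _) , minimal) r∈Q source =
    minimal ⁅ r ⁆ r-retentive (λ w∈r → subst (_∈ Q) (sym (x∈⁅y⁆⇒x≡y r w∈r)) r∈Q)
    where
    r-retentive : Retentive T τ′ X ⁅ r ⁆
    r-retentive = (λ w∈r → subst (_∈ X) (sym (x∈⁅y⁆⇒x≡y r w∈r)) (Q⊆X r∈Q))
                , (r , x∈⁅x⁆ r)
                , λ { w w∈r (u , u∈N⁻) → let u∈X , u≻w = ∈N⁻⁻ u∈N⁻ in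
                        ⊥-elim (source u∈X (subst (u ≻_) (x∈⁅y⁆⇒x≡y r w∈r) u≻w)) }

  minRetentive-cong : ∀ {τ₁ τ₂ B A} → (∀ {x} → x ∈ B → ∀ y → τ₁ (N⁻ T B x) y ⇔ τ₂ (N⁻ T B x) y) →
                      MinRetentive' T τ₁ B A → MinRetentive' T τ₂ B A
  minRetentive-cong {τ₁} {τ₂} agree (ret , minimal) =
    transfer τ₁ τ₂ (λ x∈B y → Equivalence.from (agree x∈B y)) ret ,
    λ A′ ret′ → minimal A′ (transfer τ₂ τ₁ (λ x∈B y → Equivalence.to (agree x∈B y)) ret′)
    where
    transfer : ∀ τ τ′ {B A} → (∀ {x} → x ∈ B → ∀ y → τ′ (N⁻ T B x) y → τ (N⁻ T B x) y) →
               Retentive T τ B A → Retentive T τ′ B A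
    transfer _ _ f (A⊆B , ne , closed) =
      A⊆B , ne , λ x x∈A nx y τ′y → closed x x∈A nx y (f (A⊆B x∈A) y τ′y)

  τF-fuel : ∀ {k k′ B} → ∣ B ∣ ≤ k → k ≤ k′ → ∀ y → τF T k B y ⇔ τF T k′ B y
  τF-fuel {zero} {k′} ∣B∣≤0 _ _ = mk⇔ (λ ())
    (λ τy → ⊥-elim (n≮0 (<-≤-trans (x∈p⇒∣p-x∣<∣p∣ (τF⊆ k′ τy)) ∣B∣≤0)))
  τF-fuel {suc k} {suc k′} {B} ∣B∣≤ (s≤s k≤k′) _ =
    mk⇔ (λ (A , min , y∈A) → A , minRetentive-cong {τF T k} {τF T k′} fuel-up min , y∈A)
        (λ (A , min , y∈A) → A , minRetentive-cong {τF T k′} {τF T k} (λ x∈B y → ⇔.sym (fuel-up x∈B y)) min , y∈A)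
    where
    fuel-up : ∀ {x} → x ∈ B → ∀ y → τF T k (N⁻ T B x) y ⇔ τF T k′ (N⁻ T B x) y
    fuel-up x∈B = τF-fuel (≤-pred (<-≤-trans (∣N⁻∣<∣B∣ x∈B) ∣B∣≤)) k≤k′

  minimal⊆N⁻ : ∀ {R v M} → Retentive T (τF T n) ⊤ R → v ∈ R →
               MinRetentive' T (τF T n) (N⁻ T ⊤ v) M → M ⊆ N⁻ T R v
  minimal⊆N⁻ {v = v} (_ , _ , closed) v∈R min@((M⊆N⁻ , _) , _) {w} w∈M =
    ∈N⁻⁺ (closed v v∈R (w , M⊆N⁻ w∈M) w τw) (proj₂ (∈N⁻⁻ {⊤} (M⊆N⁻ w∈M)))
    where
    τw : τF T n (N⁻ T ⊤ v) w
    τw = Equivalence.from (τF-fuel (∣p∣≤n (N⁻ T ⊤ v)) (n≤1+n n) w) (_ , min , w∈M)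

  no-source⇒3≤∣Q∣ : ∀ {Q} → Nonempty Q → (∀ {q} → q ∈ Q → ∃ λ q′ → q′ ∈ Q × q′ ≻ q) → 3 ≤ ∣ Q ∣
  no-source⇒3≤∣Q∣ (q₀ , q₀∈Q) dominated with dominated q₀∈Q
  ... | q₁ , q₁∈Q , q₁≻q₀ with dominated q₁∈Q
  ... | q₂ , q₂∈Q , q₂≻q₁ = m+n≤o⇒m≤o 3 (three-distinct-members q₀∈Q q₁∈Q q₂∈Q
          (≻⇒≢ q₁≻q₀ ∘ sym) (λ { refl → asym q₁≻q₀ q₂≻q₁ }) (≻⇒≢ q₂≻q₁ ∘ sym))

  record Captained (S : Subset n) (x y z : Fin n) : Set where
    field
      x≻y : x ≻ y
      y≻z : y ≻ z
      z≻x : z ≻ x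
      x∈S : x ∈ S
      y∈S : y ∈ S
      z∈S : z ∈ S
      dominated-by-two : ∀ {d} → d ∈ S → ¬ Among x y z d → TwoOf (x ≻ d) (y ≻ d) (z ≻ d)

  rotate : ∀ {S x y z} → Captained S x y z → Captained S y z x
  rotate Δ = record
    { x≻y = y≻z ; y≻z = z≻x ; z≻x = x≻y ; x∈S = y∈S ; y∈S = z∈S ; z∈S = x∈S
    ; dominated-by-two = λ d∈S d∉Δ → twoOf-rotate (dominated-by-two d∈S (d∉Δ ∘ among-rotate)) }
    where open Captained Δ

  module _ {S : Subset n} {x y z : Fin n} (Δ : Captained S x y z) where
    open Captained Δ

    Δ⊆S : ∀ {t} → Among x y z t → t ∈ S
    Δ⊆S (inj₁ refl)        = x∈S
    Δ⊆S (inj₂ (inj₁ refl)) = y∈S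
    Δ⊆S (inj₂ (inj₂ refl)) = z∈S

    common-dominator : ∀ {d e} → d ∈ S → ¬ Among x y z d → e ∈ S → ¬ Among x y z e →
                       ∃ λ u → u ∈ S × u ≻ d × u ≻ e
    common-dominator d∈S d∉Δ e∈S e∉Δ
      with twoOf-overlap (dominated-by-two d∈S d∉Δ) (dominated-by-two e∈S e∉Δ)
    ... | inj₁ dominators        = x , x∈S , dominators
    ... | inj₂ (inj₁ dominators) = y , y∈S , dominators
    ... | inj₂ (inj₂ dominators) = z , z∈S , dominators

    Δ-in-neighbour : ∀ {t} → Among x y z t → t ≻ x → t ≡ z
    Δ-in-neighbour (inj₁ refl)        t≻x = ⊥-elim (≻-irrefl t≻x)
    Δ-in-neighbour (inj₂ (inj₁ refl)) t≻x = ⊥-elim (asym x≻y t≻x)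
    Δ-in-neighbour (inj₂ (inj₂ t≡z))  _   = t≡z

    outside-in-neighbour : ∀ {s} → s ∈ S → ¬ Among x y z s → s ≻ x → z ≻ s
    outside-in-neighbour s∈S s∉Δ s≻x with dominated-by-two s∈S s∉Δ
    ... | inj₁ (x≻s , _)        = ⊥-elim (asym s≻x x≻s)
    ... | inj₂ (inj₁ (_ , z≻s)) = z≻s
    ... | inj₂ (inj₂ (z≻s , _)) = z≻s

    meets-triangle : ∣ S ∣ ≤ 5 → ∀ {Q} → Q ⊆ S → Nonempty Q →
                     (∀ {q} → q ∈ Q → ¬ Among x y z q → ∃ λ q′ → q′ ∈ Q × q′ ≻ q) →
                     ∃ λ t → t ∈ Q × Among x y z t
    meets-triangle ∣S∣≤5 {Q} Q⊆S ne dominated with any? (λ t → t ∈? Q ×-dec among? x y z t)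
    ... | yes hit  = hit
    ... | no  miss = ⊥-elim (n≮n 5 (≤-trans (+-monoʳ-≤ 3 3≤∣S-Δ∣) 3+∣S-Δ∣≤5))
      where
      outside : ∀ {q} → q ∈ Q → ¬ Among x y z q
      outside q∈Q q∈Δ = miss (_ , q∈Q , q∈Δ)
      Q⊆S-Δ : Q ⊆ S - x - y - z
      Q⊆S-Δ q∈Q = x∈p∧x≢y⇒x∈p-y (x∈p∧x≢y⇒x∈p-y (x∈p∧x≢y⇒x∈p-y (Q⊆S q∈Q)
        (outside q∈Q ∘ inj₁)) (outside q∈Q ∘ inj₂ ∘ inj₁)) (outside q∈Q ∘ inj₂ ∘ inj₂)
      3≤∣S-Δ∣ : 3 ≤ ∣ S - x - y - z ∣
      3≤∣S-Δ∣ = ≤-trans (no-source⇒3≤∣Q∣ ne (λ q∈Q → dominated q∈Q (outside q∈Q))) (p⊆q⇒∣p∣≤∣q∣ Q⊆S-Δ)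
      3+∣S-Δ∣≤5 : 3 + ∣ S - x - y - z ∣ ≤ 5
      3+∣S-Δ∣≤5 = ≤-trans (three-distinct-members x∈S y∈S z∈S
        (≻⇒≢ x≻y) (≻⇒≢ z≻x ∘ sym) (≻⇒≢ y≻z)) ∣S∣≤5

  -- Fuel k + 2 leaves fuel k + 1 to the minimal retentive sets of in-neighbourhoods, which
  -- is what makes their τ nonempty (retentive-dominator).
  module _ {X S : Subset n} (S⊆X : S ⊆ X) (∣S∣≤5 : ∣ S ∣ ≤ 5) (k : ℕ)
           (minimal⊆S : ∀ {M} → MinRetentive' T (τF T (suc (suc k))) X M → M ⊆ S) where

    Minimal : Subset n → Set
    Minimal = MinRetentive' T (τF T (suc (suc k))) X

    τ-at-vertex : ∀ {x y z} → Captained S x y z → ∀ {M} → Minimal M → x ∈ M →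
                  ∀ {Q} → MinRetentive' T (τF T (suc k)) (N⁻ T X x) Q → z ∈ Q × (∀ {u} → u ∈ Q → u ≡ z)
    τ-at-vertex {x} {y} {z} Δ min x∈M {Q} minQ@(retQ@(Q⊆N⁻ , ne , _) , _) =
      z∈Q , x∈⁅y⁆⇒x≡y z ∘ minRetentive⊆source {τF T (suc k)} {N⁻ T X x} minQ z∈Q z-source
      where
      open Captained Δ
      Q⊆S : Q ⊆ S
      Q⊆S = minimal⊆S min ∘ retentive-closed (proj₁ min) x∈M minQ
      ≻x : ∀ {s} → s ∈ Q → s ≻ x
      ≻x s∈Q = proj₂ (∈N⁻⁻ {X} (Q⊆N⁻ s∈Q))
      z∈N⁻ : z ∈ N⁻ T X x
      z∈N⁻ = ∈N⁻⁺ (S⊆X z∈S) z≻x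
      outside-dominated : ∀ {s} → s ∈ Q → ¬ Among x y z s → ∃ λ s′ → s′ ∈ Q × s′ ≻ s
      outside-dominated s∈Q s∉Δ =
        retentive-dominator retQ s∈Q z∈N⁻ (outside-in-neighbour Δ (Q⊆S s∈Q) s∉Δ (≻x s∈Q))
      z∈Q : z ∈ Q
      z∈Q with meets-triangle Δ ∣S∣≤5 Q⊆S ne outside-dominated
      ... | t , t∈Q , t∈Δ = subst (_∈ Q) (Δ-in-neighbour Δ t∈Δ (≻x t∈Q)) t∈Q
      z-source : ∀ {u} → u ∈ N⁻ T X x → ¬ u ≻ z
      z-source u∈N⁻ u≻z with retentive-dominator retQ z∈Q u∈N⁻ u≻z
      ... | s , s∈Q , s≻z with among? x y z s
      ...   | yes s∈Δ = ≻-irrefl (subst (_≻ z) (Δ-in-neighbour Δ s∈Δ (≻x s∈Q)) s≻z)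
      ...   | no  s∉Δ = asym s≻z (outside-in-neighbour Δ (Q⊆S s∈Q) s∉Δ (≻x s∈Q))

    predecessor∈minimal : ∀ {x y z} → Captained S x y z → ∀ {M} → Minimal M → x ∈ M → z ∈ M
    predecessor∈minimal Δ min x∈M =
      let Q , minQ = minRetentive-exists (suc k) (_ , ∈N⁻⁺ (S⊆X z∈S) z≻x)
      in  retentive-closed (proj₁ min) x∈M minQ (proj₁ (τ-at-vertex Δ min x∈M minQ))
      where open Captained Δ

    τ-at-outside-vertex-meets-triangle :
      ∀ {x y z} → Captained S x y z → ∀ {M m} → Minimal M → m ∈ M → ¬ Among x y z m →
      ∀ {Q} → MinRetentive' T (τF T (suc k)) (N⁻ T X m) Q → ∃ λ t → t ∈ Q × Among x y z t
    τ-at-outside-vertex-meets-triangle {x} {y} {z} Δ min m∈M m∉Δ {Q} minQ@(retQ@(_ , ne , _) , _) =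
      meets-triangle Δ ∣S∣≤5 Q⊆S ne dominated
      where
      Q⊆S : Q ⊆ S
      Q⊆S = minimal⊆S min ∘ retentive-closed (proj₁ min) m∈M minQ
      dominated : ∀ {s} → s ∈ Q → ¬ Among x y z s → ∃ λ s′ → s′ ∈ Q × s′ ≻ s
      dominated s∈Q s∉Δ =
        let u , u∈S , u≻s , u≻m = common-dominator Δ (Q⊆S s∈Q) s∉Δ (minimal⊆S min m∈M) m∉Δ
        in  retentive-dominator retQ s∈Q (∈N⁻⁺ (S⊆X u∈S) u≻m) u≻s

    minimal-meets-triangle : ∀ {x y z} → Captained S x y z → ∀ {M} → Minimal M →
                             ∃ λ t → t ∈ M × Among x y z t
    minimal-meets-triangle {x} {y} {z} Δ min with proj₁ (proj₂ (proj₁ min))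
    ... | m , m∈M with among? x y z m
    ...   | yes m∈Δ = m , m∈M , m∈Δ
    ...   | no  m∉Δ =
      let m∈S = minimal⊆S min m∈M
          u , u∈S , u≻m , _ = common-dominator Δ m∈S m∉Δ m∈S m∉Δ
          Q , minQ = minRetentive-exists (suc k) (u , ∈N⁻⁺ (S⊆X u∈S) u≻m)
          t , t∈Q , t∈Δ = τ-at-outside-vertex-meets-triangle Δ min m∈M m∉Δ minQ
      in  t , retentive-closed (proj₁ min) m∈M minQ t∈Q , t∈Δ

    triangle⊆minimal-from : ∀ {x y z} → Captained S x y z → ∀ {M} → Minimal M → x ∈ M →
                            ∀ {t} → Among x y z t → t ∈ M
    triangle⊆minimal-from Δ min x∈M (inj₁ refl)        = x∈M
    triangle⊆minimal-from Δ min x∈M (inj₂ (inj₁ refl)) =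
      predecessor∈minimal (rotate (rotate Δ)) min (predecessor∈minimal Δ min x∈M)
    triangle⊆minimal-from Δ min x∈M (inj₂ (inj₂ refl)) = predecessor∈minimal Δ min x∈M

    triangle⊆minimal : ∀ {x y z} → Captained S x y z → ∀ {M} → Minimal M →
                       ∀ {t} → Among x y z t → t ∈ M
    triangle⊆minimal Δ min with minimal-meets-triangle Δ min
    ... | _ , x∈M , inj₁ refl        = triangle⊆minimal-from Δ min x∈M
    ... | _ , y∈M , inj₂ (inj₁ refl) =
      triangle⊆minimal-from Δ min (predecessor∈minimal (rotate Δ) min y∈M)
    ... | _ , z∈M , inj₂ (inj₂ refl) = triangle⊆minimal-from Δ min
      (predecessor∈minimal (rotate Δ) min (predecessor∈minimal (rotate (rotate Δ)) min z∈M))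

    triangle-retentive : ∀ {x y z} → Captained S x y z → ∀ {M} → Minimal M →
                         Retentive T (τF T (suc (suc k))) X (triple x y z)
    triangle-retentive {x} {y} {z} Δ min = S⊆X ∘ Δ⊆S Δ ∘ ∈triple⁻ , (x , ∈triple⁺ (inj₁ refl)) , closed
      where
      τ-predecessor : ∀ {w Q} → Among x y z w → MinRetentive' T (τF T (suc k)) (N⁻ T X w) Q →
                      ∀ {u} → u ∈ Q → Among x y z u
      τ-predecessor w∈Δ@(inj₁ refl) minQ =
        inj₂ ∘ inj₂ ∘ proj₂ (τ-at-vertex Δ min (triangle⊆minimal Δ min w∈Δ) minQ)
      τ-predecessor w∈Δ@(inj₂ (inj₁ refl)) minQ =
        inj₁ ∘ proj₂ (τ-at-vertex (rotate Δ) min (triangle⊆minimal Δ min w∈Δ) minQ)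
      τ-predecessor w∈Δ@(inj₂ (inj₂ refl)) minQ =
        inj₂ ∘ inj₁ ∘ proj₂ (τ-at-vertex (rotate (rotate Δ)) min (triangle⊆minimal Δ min w∈Δ) minQ)
      closed : ∀ w → w ∈ triple x y z → Nonempty (N⁻ T X w) →
               ∀ u → τF T (suc (suc k)) (N⁻ T X w) u → u ∈ triple x y z
      closed w w∈Δ _ u (Q , minQ , u∈Q) = ∈triple⁺ (τ-predecessor (∈triple⁻ w∈Δ) minQ u∈Q)

    τ≡triangle : ∀ {x y z} → Captained S x y z → ∀ t →
                 τF T (suc (suc (suc k))) X t ⇔ Among x y z t
    τ≡triangle {x} {y} {z} Δ t = mk⇔
      (λ (M , min , t∈M) → ∈triple⁻ (proj₂ min (triple x y z) (triangle-retentive Δ min)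
                                       (λ u∈Δ → triangle⊆minimal Δ min (∈triple⁻ u∈Δ)) t∈M))
      (λ t∈Δ → let M , min = minRetentive-exists (suc (suc k)) (x , S⊆X (Δ⊆S Δ (inj₁ refl)))
               in  M , min , triangle⊆minimal Δ min t∈Δ)

  captained : ∀ {R v a b c} → TriCaptain T R v a b c →
              Captained (N⁻ T R v) a b c ⊎ Captained (N⁻ T R v) a c b
  captained {R} ((a∈R , b∈R , c∈R) , (a≻v , b≻v , c≻v) , inj₁ (a≻b , b≻c , c≻a) , captain) = inj₁ record
    { x≻y = a≻b ; y≻z = b≻c ; z≻x = c≻a
    ; x∈S = ∈N⁻⁺ a∈R a≻v ; y∈S = ∈N⁻⁺ b∈R b≻v ; z∈S = ∈N⁻⁺ c∈R c≻v
    ; dominated-by-two = λ d∈S d∉Δ →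
        let d∈R , d≻v = ∈N⁻⁻ {R} d∈S
            d≢a = d∉Δ ∘ inj₁ ; d≢b = d∉Δ ∘ inj₂ ∘ inj₁ ; d≢c = d∉Δ ∘ inj₂ ∘ inj₂
            ¬ab , ¬bc , ¬ac = captain _ d∈R d≻v d≢a d≢b d≢c
        in  two-dominators d≢a d≢b d≢c ¬ab ¬bc ¬ac }
  captained {R} ((a∈R , b∈R , c∈R) , (a≻v , b≻v , c≻v) , inj₂ (a≻c , c≻b , b≻a) , captain) = inj₂ record
    { x≻y = a≻c ; y≻z = c≻b ; z≻x = b≻a
    ; x∈S = ∈N⁻⁺ a∈R a≻v ; y∈S = ∈N⁻⁺ c∈R c≻v ; z∈S = ∈N⁻⁺ b∈R b≻v
    ; dominated-by-two = λ d∈S d∉Δ →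
        let d∈R , d≻v = ∈N⁻⁻ {R} d∈S
            d≢a = d∉Δ ∘ inj₁ ; d≢c = d∉Δ ∘ inj₂ ∘ inj₁ ; d≢b = d∉Δ ∘ inj₂ ∘ inj₂
            ¬ab , ¬bc , ¬ac = captain _ d∈R d≻v d≢a d≢b d≢c
        in  two-dominators d≢a d≢c d≢b ¬ac (λ (d≻c , d≻b) → ¬bc (d≻b , d≻c)) ¬ab }

lemma9 : {n : ℕ} (T : Tournament n) (R : Subset n) (v a b c : Fin n) →
    MinRetentive T ⊤ R → v ∈ R →
    TriCaptain T R v a b c →
    ∣ N⁻ T R v ∣ ≤ 5 →
    ∀ y → (τ T (N⁻ T ⊤ v) y ⇔ (y ≡ a ⊎ y ≡ b ⊎ y ≡ c))
lemma9 {suc zero} T R zero zero _ _ _ _ (_ , (a≻v , _) , _) _ _ = ⊥-elim (≻-irrefl T a≻v)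
lemma9 {suc (suc m)} T R v a b c (retR , _) v∈R captain ∣S∣≤5 t =
  [ τ≡triangle′ , (λ Δ → ⇔.trans (τ≡triangle′ Δ) (mk⇔ among-swap among-swap)) ] (captained T captain)
  where
  τ≡triangle′ : ∀ {x y z} → Captained T (N⁻ T R v) x y z → τ T (N⁻ T ⊤ v) t ⇔ Among x y z t
  τ≡triangle′ Δ = τ≡triangle T (N⁻-mono T {R} λ _ → ∈⊤) ∣S∣≤5 m (minimal⊆N⁻ T retR v∈R) Δ t
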